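{- For every permutation $\rho\in\mathcal{S}_k$ and every $n\ge 0$, $\mathrm{r}_n(\rho)=\mathrm{s}_n(\rho^{\leftrightarrow})$.
   Context: $\mathcal{S}_n$ is the set of permutations of $[n]$, $\pi^r$ the reversal of $\pi$. A word $w$ contains $\rho\in\mathcal{S}_k$ if some subsequence $w_{i_1}\cdots w_{i_k}$ ($i_1<\cdots<i_k$) satisfies $w_{i_a}\le w_{i_b}$ iff $\rho_a\le\rho_b$; otherwise it avoids $\rho$. $\mathcal{R}_n=\{\pi\pi^r:\pi\in\mathcal{S}_n\}$ (concatenation of $\pi$ with its reversal), and $\mathrm{r}_n(\rho)$ is the number of members of $\mathcal{R}_n$ avoiding $\rho$. For a set $B$ of permutations, $\mathrm{s}_n(B)$ is the number of $\pi\in\mathcal{S}_n$ avoiding every member of $B$. A shuffle of words $\alpha_1\cdots\alpha_i$ and $\beta_1\cdots\beta_j$ is a word of length $i+j$ whose positions can be split into two disjoint subsequences, one equal to $\alpha$ and the other equal to $\beta$. For $\rho\in\mathcal{S}_k$, $\rho^{\leftrightarrow}$ is the set of all permutations that are shuffles of $\rho_1\cdots\rho_i$ and $\rho_k\rho_{k-1}\cdots\rho_{i+1}$ for some $1\le i\le k$. -}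

module Defs where

open import Data.Nat using (ℕ; zero; suc; _≤_; _≤?_; _≟_)
open import Data.List using (List; []; _∷_; _++_; map; concatMap; length; reverse; take; drop; zip; filter; applyUpTo)
open import Data.List.Relation.Unary.All using (All; all?)
open import Data.List.Relation.Unary.Any using (Any; any?)
open import Data.List.Relation.Unary.AllPairs using (AllPairs; allPairs?)
open import Data.Product using (_×_; _,_)
open import Relation.Nullary using (¬_; Dec; ¬?)
open import Relation.Nullary.Decidable using (_×-dec_; _→-dec_)
open import Relation.Binary.PropositionalEquality using (_≡_; _≢_)

Perm : ℕ → List ℕ → Set
Perm n π = (length π ≡ n) × All (λ x → (1 ≤ x) × (x ≤ n)) π × AllPairs _≢_ π

perm? : ∀ n π → Dec (Perm n π)
perm? n π = (length π ≟ n) ×-dec all? (λ x → (1 ≤? x) ×-dec (x ≤? n)) π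
              ×-dec allPairs? (λ x y → ¬? (x ≟ y)) π

words : ℕ → ℕ → List (List ℕ)
words n zero    = [] ∷ []
words n (suc k) = concatMap (λ w → map (_∷ w) (applyUpTo suc n)) (words n k)

perms : ℕ → List (List ℕ)
perms n = filter (perm? n) (words n n)

subseqs : List ℕ → List (List ℕ)
subseqs []       = [] ∷ []
subseqs (x ∷ xs) = map (x ∷_) (subseqs xs) ++ subseqs xs

pairs : {A : Set} → List A → List (A × A)
pairs xs = concatMap (λ x → map (λ y → (x , y)) xs) xs

OrderIso : List ℕ → List ℕ → Set
OrderIso u ρ = (length u ≡ length ρ) ×
  All (λ { ((ua , ρa) , (ub , ρb)) → ((ua ≤ ub) → (ρa ≤ ρb)) × ((ρa ≤ ρb) → (ua ≤ ub)) })
      (pairs (zip u ρ))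

orderIso? : ∀ u ρ → Dec (OrderIso u ρ)
orderIso? u ρ = (length u ≟ length ρ) ×-dec
  all? (λ { ((ua , ρa) , (ub , ρb)) → ((ua ≤? ub) →-dec (ρa ≤? ρb)) ×-dec ((ρa ≤? ρb) →-dec (ua ≤? ub)) })
       (pairs (zip u ρ))

Contains : List ℕ → List ℕ → Set
Contains w ρ = Any (λ u → OrderIso u ρ) (subseqs w)

contains? : ∀ w ρ → Dec (Contains w ρ)
contains? w ρ = any? (λ u → orderIso? u ρ) (subseqs w)

Avoids : List ℕ → List ℕ → Set
Avoids w ρ = ¬ Contains w ρ

avoids? : ∀ w ρ → Dec (Avoids w ρ)
avoids? w ρ = ¬? (contains? w ρ)

-- r_n(ρ) = #{ π π^r ∈ R_n : π π^r avoids ρ }   (π ↦ π π^r is injective)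
r : ℕ → List ℕ → ℕ
r n ρ = length (filter (λ π → avoids? (π ++ reverse π) ρ) (perms n))

AvoidsAll : List (List ℕ) → List ℕ → Set
AvoidsAll B π = All (Avoids π) B

s : ℕ → List (List ℕ) → ℕ
s n B = length (filter (λ π → all? (avoids? π) B) (perms n))

shuffles : List ℕ → List ℕ → List (List ℕ)
shuffles []       ys       = ys ∷ []
shuffles (x ∷ xs) []       = (x ∷ xs) ∷ []
shuffles (x ∷ xs) (y ∷ ys) = map (x ∷_) (shuffles xs (y ∷ ys)) ++ map (y ∷_) (shuffles (x ∷ xs) ys)

-- ρ^↔ : all shuffles of ρ_1⋯ρ_i and ρ_k ρ_{k-1} ⋯ ρ_{i+1}, for 1 ≤ i ≤ k = length ρ
-- (listed possibly with repetitions; this does not affect avoidance of all members)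
leftright : List ℕ → List (List ℕ)
leftright ρ = concatMap (λ i → shuffles (take i ρ) (reverse (drop i ρ))) (applyUpTo suc (length ρ))

-- An occurrence of ρ in ππ^r reads a prefix ρ₁⋯ρᵢ in π and the remaining suffix in
-- π^r, i.e. backwards in π. As the letters of ρ are distinct, the two parts never use
-- the same letter of π, so together they form an occurrence in π of a shuffle of
-- ρ₁⋯ρᵢ with ρₖ⋯ρᵢ₊₁; conversely an occurrence of such a shuffle in π splits back
-- into the two parts. Hence ππ^r avoids ρ exactly when π avoids every member of ρ^↔,
-- and r n ρ and s n ρ^↔ filter the same list by equivalent predicates.
module Submission where

open import Defs
open import Data.Nat using (ℕ; suc; _≤_; s≤s)
open import Data.Nat.Properties using (≤-antisym; ≤-refl; suc-injective)
open import Data.List using (List; []; _∷_; _++_; map; reverse; take; drop; zip; length; applyUpTo; concatMap; cartesianProduct)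
open import Data.List.Properties using (map-++; reverse-map; reverse-involutive; length-map; length-++-≤ˡ; take++drop≡id; filter-≐)
open import Data.List.Membership.Propositional using (_∈_; find; lose)
open import Data.List.Membership.Propositional.Properties using (∈-map⁺; ∈-map⁻; ∈-++⁺ˡ; ∈-++⁺ʳ; ∈-++⁻; ∈-applyUpTo⁺; ∈-concatMap⁺; ∈-concatMap⁻; ∈-cartesianProduct⁺; ∈-cartesianProduct⁻)
open import Data.List.Relation.Unary.Any using (Any; here; there)
import Data.List.Relation.Unary.Any as Any
import Data.List.Relation.Unary.Any.Properties as Any
open import Data.List.Relation.Unary.All using (All)
import Data.List.Relation.Unary.All as All
open import Data.List.Relation.Unary.All.Properties using (¬Any⇒All¬; All¬⇒¬Any)
import Data.List.Relation.Unary.All.Properties as All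
open import Data.List.Relation.Unary.AllPairs using (AllPairs; _∷_)
open import Data.List.Relation.Binary.Disjoint.Propositional using (Disjoint)
import Data.List.Relation.Binary.Pointwise as Pointwise
open import Data.List.Relation.Binary.Sublist.Heterogeneous using (Sublist; []; _∷_; _∷ʳ_; fromAny; toAny)
import Data.List.Relation.Binary.Sublist.Heterogeneous.Properties as Sublist
open import Data.List.Relation.Binary.Sublist.Propositional using (_⊆_)
import Data.List.Relation.Binary.Subset.Propositional as Subset
import Data.List.Relation.Binary.Subset.Propositional.Properties as Subset
open import Data.List.Relation.Binary.Permutation.Propositional using (↭-sym)
open import Data.List.Relation.Binary.Permutation.Propositional.Properties using (↭-reverse)
open import Data.List.Relation.Ternary.Interleaving.Propositional using (Interleaving; []; consˡ; consʳ; left; right; swap; toPermutation)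
import Data.List.Relation.Ternary.Interleaving as Interleaving
import Data.List.Relation.Ternary.Interleaving.Properties as Interleaving
open import Data.Product using (_×_; _,_; proj₁; proj₂; ∃; ∃₂)
open import Data.Sum using (inj₁; inj₂)
open import Function using (_∘_; _⇔_; mk⇔; Equivalence)
open import Relation.Binary.PropositionalEquality using (_≡_; _≢_; refl; sym; trans; cong; cong₂; subst; subst₂; module ≡-Reasoning)
open import Relation.Unary using (_≐_)

private
  variable
    A B : Set

take-length-++ : (xs : List A) {ys : List A} → take (length xs) (xs ++ ys) ≡ xs
take-length-++ []       = refl
take-length-++ (x ∷ xs) = cong (x ∷_) (take-length-++ xs)

drop-length-++ : (xs : List A) {ys : List A} → drop (length xs) (xs ++ ys) ≡ ys
drop-length-++ []       = refl
drop-length-++ (x ∷ xs) = drop-length-++ xs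

zip-map-proj : (Z : List (A × B)) → zip (map proj₁ Z) (map proj₂ Z) ≡ Z
zip-map-proj []      = refl
zip-map-proj (z ∷ Z) = cong (z ∷_) (zip-map-proj Z)

map-proj₂-zip : {xs : List A} {ys : List B} → length xs ≡ length ys → map proj₂ (zip xs ys) ≡ ys
map-proj₂-zip {xs = []}     {[]}     _ = refl
map-proj₂-zip {xs = x ∷ xs} {y ∷ ys} e = cong (y ∷_) (map-proj₂-zip (suc-injective e))

distinct-++⇒disjoint : (xs : List A) {ys : List A} → AllPairs _≢_ (xs ++ ys) → Disjoint xs ys
distinct-++⇒disjoint (x ∷ xs) (x∉ ∷ _) (here refl , v∈ys) = All.lookup (All.++⁻ʳ xs x∉) v∈ys refl
distinct-++⇒disjoint (x ∷ xs) (_ ∷ d)  (there v∈xs , v∈ys) = distinct-++⇒disjoint xs d (v∈xs , v∈ys)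

pairs≡cartesianProduct : (xs : List A) → pairs xs ≡ cartesianProduct xs xs
pairs≡cartesianProduct xs = go xs
  where
  go : (ys : List _) → concatMap (λ y → map (λ x → (y , x)) xs) ys ≡ cartesianProduct ys xs
  go []       = refl
  go (y ∷ ys) = cong (map (y ,_) xs ++_) (go ys)

All-pairs⁺ : {P : A × A → Set} {xs : List A} →
             (∀ {x y} → x ∈ xs → y ∈ xs → P (x , y)) → All P (pairs xs)
All-pairs⁺ {xs = xs} f rewrite pairs≡cartesianProduct xs =
  All.tabulate λ m → let x∈ , y∈ = ∈-cartesianProduct⁻ xs xs m in f x∈ y∈

All-pairs⁻ : {P : A × A → Set} {xs : List A} →
             All P (pairs xs) → ∀ {x y} → x ∈ xs → y ∈ xs → P (x , y)
All-pairs⁻ {xs = xs} h x∈ y∈ rewrite pairs≡cartesianProduct xs =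
  All.lookup h (∈-cartesianProduct⁺ x∈ y∈)

Sublist-++-split : {R : A → B → Set} {zs : List A} (xs : List B) {ys : List B} →
                   Sublist R zs (xs ++ ys) →
                   ∃₂ λ as bs → zs ≡ as ++ bs × Sublist R as xs × Sublist R bs ys
Sublist-++-split []       s = [] , _ , refl , [] , s
Sublist-++-split (x ∷ xs) (.x ∷ʳ s) with as , bs , refl , s₁ , s₂ ← Sublist-++-split xs s =
  as , bs , refl , x ∷ʳ s₁ , s₂
Sublist-++-split (x ∷ xs) (r ∷ s) with as , bs , refl , s₁ , s₂ ← Sublist-++-split xs s =
  _ ∷ as , bs , refl , r ∷ s₁ , s₂

∈-subseqs⁺ : {u w : List ℕ} → u ⊆ w → u ∈ subseqs w
∈-subseqs⁺ []                    = here refl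
∈-subseqs⁺ {w = _ ∷ w} (y ∷ʳ s) = ∈-++⁺ʳ (map (y ∷_) (subseqs w)) (∈-subseqs⁺ s)
∈-subseqs⁺ (refl ∷ s)            = ∈-++⁺ˡ (∈-map⁺ _ (∈-subseqs⁺ s))

∈-subseqs⁻ : {u : List ℕ} (w : List ℕ) → u ∈ subseqs w → u ⊆ w
∈-subseqs⁻ []       (here refl) = []
∈-subseqs⁻ (x ∷ xs) u∈ with ∈-++⁻ (map (x ∷_) (subseqs xs)) u∈
... | inj₁ u∈₁ with _ , u∈₂ , refl ← ∈-map⁻ _ u∈₁ = refl ∷ ∈-subseqs⁻ xs u∈₂
... | inj₂ u∈₂ = x ∷ʳ ∈-subseqs⁻ xs u∈₂

interleaving-[]ʳ : {xs zs : List A} → Interleaving xs [] zs → zs ≡ xs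
interleaving-[]ʳ []         = refl
interleaving-[]ʳ (consˡ sp) = cong (_ ∷_) (interleaving-[]ʳ sp)

interleaving⇒⊆ˡ : {xs ys zs : List A} → Interleaving xs ys zs → xs ⊆ zs
interleaving⇒⊆ˡ []         = []
interleaving⇒⊆ˡ (consˡ sp) = refl ∷ interleaving⇒⊆ˡ sp
interleaving⇒⊆ˡ (consʳ sp) = _ ∷ʳ interleaving⇒⊆ˡ sp

interleaving⇒⊆ʳ : {xs ys zs : List A} → Interleaving xs ys zs → ys ⊆ zs
interleaving⇒⊆ʳ = interleaving⇒⊆ˡ ∘ swap

interleaving-map⁺ : (f : A → B) {xs ys zs : List A} →
                    Interleaving xs ys zs → Interleaving (map f xs) (map f ys) (map f zs)
interleaving-map⁺ f = Interleaving.map⁺ f f f ∘ Interleaving.map (cong f) (cong f)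

interleaving-map⁻ : (f : A → B) (zs : List A) {xs′ ys′ : List B} →
                    Interleaving xs′ ys′ (map f zs) →
                    ∃₂ λ xs ys → Interleaving xs ys zs × map f xs ≡ xs′ × map f ys ≡ ys′
interleaving-map⁻ f []       []         = [] , [] , [] , refl , refl
interleaving-map⁻ f (z ∷ zs) (consˡ sp) with xs , ys , sp′ , refl , refl ← interleaving-map⁻ f zs sp =
  z ∷ xs , ys , consˡ sp′ , refl , refl
interleaving-map⁻ f (z ∷ zs) (consʳ sp) with xs , ys , sp′ , refl , refl ← interleaving-map⁻ f zs sp =
  xs , z ∷ ys , consʳ sp′ , refl , refl

∈-shuffles⁺ : {xs ys zs : List ℕ} → Interleaving xs ys zs → zs ∈ shuffles xs ys
∈-shuffles⁺ {[]}                sp         = here (interleaving-[]ʳ (swap sp))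
∈-shuffles⁺ {_ ∷ _}  {[]}       sp         = here (interleaving-[]ʳ sp)
∈-shuffles⁺ {x ∷ xs} {y ∷ ys}   (consˡ sp) = ∈-++⁺ˡ (∈-map⁺ (x ∷_) (∈-shuffles⁺ sp))
∈-shuffles⁺ {x ∷ xs} {y ∷ ys}   (consʳ sp) =
  ∈-++⁺ʳ (map (x ∷_) (shuffles xs (y ∷ ys))) (∈-map⁺ (y ∷_) (∈-shuffles⁺ sp))

∈-shuffles⁻ : (xs ys : List ℕ) {zs : List ℕ} → zs ∈ shuffles xs ys → Interleaving xs ys zs
∈-shuffles⁻ []       ys       (here refl) = right (Pointwise.refl refl)
∈-shuffles⁻ (x ∷ xs) []       (here refl) = left (Pointwise.refl refl)
∈-shuffles⁻ (x ∷ xs) (y ∷ ys) zs∈ with ∈-++⁻ (map (x ∷_) (shuffles xs (y ∷ ys))) zs∈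
... | inj₁ zs∈₁ with _ , zs∈₂ , refl ← ∈-map⁻ _ zs∈₁ = consˡ (∈-shuffles⁻ xs (y ∷ ys) zs∈₂)
... | inj₂ zs∈₁ with _ , zs∈₂ , refl ← ∈-map⁻ _ zs∈₁ = consʳ (∈-shuffles⁻ (x ∷ xs) ys zs∈₂)

∈-leftright⁺ : (x : ℕ) (xs ys : List ℕ) {σ : List ℕ} →
               Interleaving (x ∷ xs) (reverse ys) σ → σ ∈ leftright (x ∷ xs ++ ys)
∈-leftright⁺ x xs ys {σ} sp =
  ∈-concatMap⁺ (λ i → shuffles (take i ρ) (reverse (drop i ρ)))
    (lose (∈-applyUpTo⁺ suc (s≤s (length-++-≤ˡ xs))) (∈-shuffles⁺ (subst₂ (λ l r → Interleaving l r σ)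
      (cong (x ∷_) (sym (take-length-++ xs))) (cong reverse (sym (drop-length-++ xs))) sp)))
  where ρ = x ∷ xs ++ ys

∈-leftright⁻ : {ρ σ : List ℕ} → σ ∈ leftright ρ →
               ∃ λ i → Interleaving (take i ρ) (reverse (drop i ρ)) σ
∈-leftright⁻ {ρ} σ∈
  with i , _ , σ∈ᵢ ← find (∈-concatMap⁻ (λ i → shuffles (take i ρ) (reverse (drop i ρ)))
                                       {applyUpTo suc (length ρ)} σ∈) =
  i , ∈-shuffles⁻ _ _ σ∈ᵢ

Compatible : ℕ × ℕ → ℕ × ℕ → Set
Compatible (a , b) (c , d) = (a ≤ c → b ≤ d) × (b ≤ d → a ≤ c)

Coherent : List (ℕ × ℕ) → Set
Coherent Z = ∀ {p q} → p ∈ Z → q ∈ Z → Compatible p q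

coherent-⊆ : {Y Z : List (ℕ × ℕ)} → Y Subset.⊆ Z → Coherent Z → Coherent Y
coherent-⊆ Y⊆Z c p∈ q∈ = c (Y⊆Z p∈) (Y⊆Z q∈)

coherent-functional : {Z : List (ℕ × ℕ)} → Coherent Z →
                      ∀ {p q} → p ∈ Z → q ∈ Z → proj₁ p ≡ proj₁ q → proj₂ p ≡ proj₂ q
coherent-functional c p∈ q∈ eq =
  ≤-antisym (proj₁ (c p∈ q∈) (subst (_ ≤_) eq ≤-refl)) (proj₁ (c q∈ p∈) (subst (_≤ _) eq ≤-refl))

orderIso⇒coherent : {u ρ : List ℕ} → OrderIso u ρ → Coherent (zip u ρ)
orderIso⇒coherent (_ , h) = All-pairs⁻ h

coherent⇒orderIso : {Z : List (ℕ × ℕ)} → Coherent Z → OrderIso (map proj₁ Z) (map proj₂ Z)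
coherent⇒orderIso {Z} c =
  trans (length-map proj₁ Z) (sym (length-map proj₂ Z)) ,
  subst (λ W → All _ (pairs W)) (sym (zip-map-proj Z)) (All-pairs⁺ c)

infix 4 _↪_

_↪_ : List (ℕ × ℕ) → List ℕ → Set
Z ↪ w = Sublist (λ z x → proj₁ z ≡ x) Z w

↪⇒⊆ : {Z : List (ℕ × ℕ)} {w : List ℕ} → Z ↪ w → map proj₁ Z ⊆ w
↪⇒⊆ []       = []
↪⇒⊆ (x ∷ʳ e) = x ∷ʳ ↪⇒⊆ e
↪⇒⊆ (r ∷ e)  = r ∷ ↪⇒⊆ e

zip-↪ : {u w : List ℕ} (ρ : List ℕ) → u ⊆ w → length u ≡ length ρ → zip u ρ ↪ w
zip-↪ ρ       []         _ = []
zip-↪ ρ       (x ∷ʳ s)   e = x ∷ʳ zip-↪ ρ s e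
zip-↪ (_ ∷ ρ) (refl ∷ s) e = refl ∷ zip-↪ ρ s (suc-injective e)

⊆-↪-trans : {Y Z : List (ℕ × ℕ)} {w : List ℕ} → Y ⊆ Z → Z ↪ w → Y ↪ w
⊆-↪-trans = Sublist.trans λ { refl e → e }

↪-reverse : {Z : List (ℕ × ℕ)} {w : List ℕ} → Z ↪ reverse w → reverse Z ↪ w
↪-reverse {w = w} e = subst (_ ↪_) (reverse-involutive w) (Sublist.reverse⁺ e)

-- Coherence depends only on the set of pairs, so occurrences can be
-- cut up and reassembled in any order.
record Occurrence (w ρ : List ℕ) : Set where
  constructor occurrence
  field
    graph    : List (ℕ × ℕ)
    embeds   : graph ↪ w
    labels   : map proj₂ graph ≡ ρ
    coherent : Coherent graph

contains⇒occurrence : {w ρ : List ℕ} → Contains w ρ → Occurrence w ρ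
contains⇒occurrence {w} {ρ} c with u , u∈ , oi ← find c =
  occurrence (zip u ρ) (zip-↪ ρ (∈-subseqs⁻ w u∈) (proj₁ oi))
             (map-proj₂-zip (proj₁ oi)) (orderIso⇒coherent oi)

occurrence⇒contains : {w ρ : List ℕ} → Occurrence w ρ → Contains w ρ
occurrence⇒contains (occurrence Z e refl c) = lose (∈-subseqs⁺ (↪⇒⊆ e)) (coherent⇒orderIso c)

↪-merge : {X Y : List (ℕ × ℕ)} {w : List ℕ} → X ↪ w → Y ↪ w →
        (∀ {p q} → p ∈ X → q ∈ Y → proj₁ p ≢ proj₁ q) →
        ∃ λ V → Interleaving X Y V × V ↪ w
↪-merge [] [] _ = [] , [] , []
↪-merge (x ∷ʳ eX) (_ ∷ʳ eY) sep with V , sp , eV ← ↪-merge eX eY sep = V , sp , x ∷ʳ eV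
↪-merge (r ∷ eX) (_ ∷ʳ eY) sep with V , sp , eV ← ↪-merge eX eY (sep ∘ there) = _ , consˡ sp , r ∷ eV
↪-merge (_ ∷ʳ eX) (r ∷ eY) sep with V , sp , eV ← ↪-merge eX eY (λ p∈ → sep p∈ ∘ there) =
  _ , consʳ sp , r ∷ eV
↪-merge (r ∷ _) (r′ ∷ _) sep with () ← sep (here refl) (here refl) (trans r (sym r′))

coherent-distinct⇒separated : (X : List (ℕ × ℕ)) {Y : List (ℕ × ℕ)} →
                              Coherent (X ++ Y) → AllPairs _≢_ (map proj₂ (X ++ Y)) →
                              ∀ {p q} → p ∈ X → q ∈ Y → proj₁ p ≢ proj₁ q
coherent-distinct⇒separated X {Y} c distinct p∈ q∈ eq =
  distinct-++⇒disjoint (map proj₂ X) (subst (AllPairs _≢_) (map-++ proj₂ X Y) distinct)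
    (∈-map⁺ proj₂ p∈ , subst (_∈ map proj₂ Y) (sym same-label) (∈-map⁺ proj₂ q∈))
  where
  same-label = coherent-functional c (∈-++⁺ˡ p∈) (∈-++⁺ʳ X q∈) eq

↪-++-reverse-split : {Z : List (ℕ × ℕ)} {π : List ℕ} → Z ↪ π ++ reverse π → 1 ≤ length Z →
                     ∃₂ λ a A → ∃ λ B → Z ≡ a ∷ A ++ B × a ∷ A ↪ π × reverse B ↪ π
↪-++-reverse-split {π = π} e nonempty with Sublist-++-split π e
... | a ∷ A , B , refl , eA , eB = a , A , B , refl , eA , ↪-reverse eB
-- The occurrence lies inside π^r: its first letter is moved to the front part,
-- since ρ^↔ only splits ρ after a nonempty prefix.
... | [] , b ∷ B , refl , _ , eB =
  b , [] , B , refl , ↪-reverse (fromAny (toAny eB)) , ↪-reverse (Sublist.∷ˡ⁻ eB)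
↪-++-reverse-split e () | [] , [] , refl , _ , _

occurrence-++-reverse⁻ : {π ρ : List ℕ} → AllPairs _≢_ ρ → 1 ≤ length ρ →
                         Occurrence (π ++ reverse π) ρ → Any (Occurrence π) (leftright ρ)
occurrence-++-reverse⁻ {π} distinct nonempty (occurrence Z e refl c)
  with a , A , B , refl , eA , eB ←
         ↪-++-reverse-split {π = π} e (subst (1 ≤_) (length-map proj₂ Z) nonempty)
  with V , sp , eV ←
         ↪-merge eA eB (λ p∈ → coherent-distinct⇒separated (a ∷ A) c distinct p∈ ∘ Any.reverse⁻) =
  lose σ∈ (occurrence V eV refl (coherent-⊆ V⊆Z c))
  where
  V⊆Z : V Subset.⊆ a ∷ A ++ B
  V⊆Z = Subset.⊆-trans (Subset.⊆-reflexive-↭ (toPermutation sp))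
                       (Subset.++⁺ Subset.⊆-refl (Subset.⊆-reflexive-↭ (↭-reverse B)))

  σ∈ : map proj₂ V ∈ leftright (map proj₂ (a ∷ A ++ B))
  σ∈ = subst (λ ρ → map proj₂ V ∈ leftright ρ) (sym (map-++ proj₂ (a ∷ A) B))
         (∈-leftright⁺ (proj₂ a) (map proj₂ A) (map proj₂ B)
           (subst (λ r → Interleaving _ r _) (reverse-map proj₂ B) (interleaving-map⁺ proj₂ sp)))

occurrence-++-reverse⁺ : {π ρ σ : List ℕ} → σ ∈ leftright ρ → Occurrence π σ →
                         Occurrence (π ++ reverse π) ρ
occurrence-++-reverse⁺ {π} {ρ} σ∈ (occurrence V e refl c)
  with i , sp ← ∈-leftright⁻ σ∈
  with P , Q , spV , eP , eQ ← interleaving-map⁻ proj₂ V sp =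
  occurrence (P ++ reverse Q)
             (Sublist.++⁺ (⊆-↪-trans (interleaving⇒⊆ˡ spV) e)
                          (Sublist.reverse⁺ (⊆-↪-trans (interleaving⇒⊆ʳ spV) e)))
             labels
             (coherent-⊆ PQ⊆V c)
  where
  labels : map proj₂ (P ++ reverse Q) ≡ ρ
  labels = begin
    map proj₂ (P ++ reverse Q)                 ≡⟨ map-++ proj₂ P (reverse Q) ⟩
    map proj₂ P ++ map proj₂ (reverse Q)       ≡⟨ cong (map proj₂ P ++_) (reverse-map proj₂ Q) ⟩
    map proj₂ P ++ reverse (map proj₂ Q)       ≡⟨ cong₂ (λ l r → l ++ reverse r) eP eQ ⟩
    take i ρ ++ reverse (reverse (drop i ρ))   ≡⟨ cong (take i ρ ++_) (reverse-involutive (drop i ρ)) ⟩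
    take i ρ ++ drop i ρ                       ≡⟨ take++drop≡id i ρ ⟩
    ρ                                          ∎
    where open ≡-Reasoning

  PQ⊆V : P ++ reverse Q Subset.⊆ V
  PQ⊆V = Subset.⊆-trans (Subset.++⁺ Subset.⊆-refl (Subset.⊆-reflexive-↭ (↭-reverse Q)))
                        (Subset.⊆-reflexive-↭ (↭-sym (toPermutation spV)))

contains-++-reverse⇔ : {π ρ : List ℕ} → AllPairs _≢_ ρ → 1 ≤ length ρ →
                       Contains (π ++ reverse π) ρ ⇔ Any (Contains π) (leftright ρ)
contains-++-reverse⇔ {π} distinct nonempty = mk⇔
  (Any.map (occurrence⇒contains {π}) ∘ occurrence-++-reverse⁻ distinct nonempty ∘ contains⇒occurrence)
  (λ c → let σ , σ∈ , cσ = find c in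
         occurrence⇒contains (occurrence-++-reverse⁺ σ∈ (contains⇒occurrence {π} cσ)))

avoids-++-reverse≐ : {ρ : List ℕ} → AllPairs _≢_ ρ → 1 ≤ length ρ →
                     (λ π → Avoids (π ++ reverse π) ρ) ≐ AvoidsAll (leftright ρ)
avoids-++-reverse≐ distinct nonempty =
  (λ {π} avoids → ¬Any⇒All¬ _ (avoids ∘ Equivalence.from (contains-++-reverse⇔ {π} distinct nonempty))) ,
  (λ {π} avoidsAll → All¬⇒¬Any avoidsAll ∘ Equivalence.to (contains-++-reverse⇔ {π} distinct nonempty))

theorem16 : (k : ℕ) → 1 ≤ k → (ρ : List ℕ) → Perm k ρ →
            (n : ℕ) → r n ρ ≡ s n (leftright ρ)
theorem16 _ nonempty ρ (refl , _ , distinct) n =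
  cong length (filter-≐ _ _ (avoids-++-reverse≐ distinct nonempty) (perms n))
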